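{- Let $\Lambda$ be a normal modal logic of Type A or Type B, and let $M\subseteq\{\Diamond,\Box\}$. Given two finite $M$-simple sets of modal formulas $\Phi,\Psi$, it is decidable whether $\mathrm{ML}_\Phi\preceq^\Lambda\mathrm{ML}_\Psi$.
   Context: A normal modal logic is a set of unimodal formulas containing all propositional tautologies, the K axiom and $\Diamond\varphi\leftrightarrow\neg\Box\neg\varphi$, closed under modus ponens, uniform substitution and necessitation; $\Lambda\vdash\phi$ means $\phi\in\Lambda$. $F_\circ$ ($F_\bullet$) is the one-world Kripke frame with a reflexive (irreflexive) world. $\Lambda$ is of Type A if $F_\circ\models\Lambda$, and of Type B if $F_\bullet\models\Lambda$ and $\Lambda\vdash\Box^n\bot$ for some $n\ge1$ (where $\Box^n$ is $n$ iterated boxes). For a set $\Phi$ of modal formulas, $\mathrm{ML}_\Phi$ is the smallest set containing all propositional variables and containing $\phi(\psi_1,\dots,\psi_n)$ (uniform substitution of $\psi_i$ for $x_i$) whenever $\phi(x_1,\dots,x_n)\in\Phi$ and $\psi_i\in\mathrm{ML}_\Phi$. $\mathrm{ML}_\Phi\preceq^\Lambda\mathrm{ML}_\Psi$ means every formula of $\mathrm{ML}_\Phi$ is $\Lambda$-provably equivalent to a formula of $\mathrm{ML}_\Psi$. A set $\Phi$ is $M$-simple if it consists of $\Diamond x$ exactly when $\Diamond\in M$, $\Box x$ exactly when $\Box\in M$, plus any number of purely propositional formulas. -}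

module Defs where

open import Data.Nat using (ℕ; zero; suc)
open import Data.Bool using (Bool; true; false; not; _∧_; _∨_; if_then_else_)
open import Data.List using (List)
open import Data.List.Membership.Propositional using (_∈_)
open import Data.List.Relation.Unary.All using (All)
open import Data.Product using (Σ; _×_; ∃)
open import Data.Sum using (_⊎_)
open import Relation.Binary.PropositionalEquality using (_≡_)
open import Function.Bundles using (_⇔_)

infixr 5 _⇒_
infixr 6 _∨f_
infixr 7 _∧f_
infix 4 _⇔f_
infix 9 ¬f_ □_ ◇_

data Formula : Set where
  var  : ℕ → Formula
  ⊥f   : Formula
  ¬f_  : Formula → Formula
  _∧f_ : Formula → Formula → Formula
  _∨f_ : Formula → Formula → Formula
  _⇒_  : Formula → Formula → Formula
  □_   : Formula → Formula
  ◇_   : Formula → Formula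

_⇔f_ : Formula → Formula → Formula
φ ⇔f ψ = (φ ⇒ ψ) ∧f (ψ ⇒ φ)

□^ : ℕ → Formula → Formula
□^ zero    φ = φ
□^ (suc n) φ = □ (□^ n φ)

subst : (ℕ → Formula) → Formula → Formula
subst σ (var x)  = σ x
subst σ ⊥f       = ⊥f
subst σ (¬f φ)   = ¬f subst σ φ
subst σ (φ ∧f ψ) = subst σ φ ∧f subst σ ψ
subst σ (φ ∨f ψ) = subst σ φ ∨f subst σ ψ
subst σ (φ ⇒ ψ)  = subst σ φ ⇒ subst σ ψ
subst σ (□ φ)    = □ subst σ φ
subst σ (◇ φ)    = ◇ subst σ φ

-- Propositional tautologies: formulas true under every Boolean valuation
-- that treats variables and modal subformulas (□φ, ◇φ) as atoms.
-- (These are exactly the substitution instances of propositional tautologies.)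

peval : (Formula → Bool) → Formula → Bool
peval v (var x)  = v (var x)
peval v ⊥f       = false
peval v (¬f φ)   = not (peval v φ)
peval v (φ ∧f ψ) = peval v φ ∧ peval v ψ
peval v (φ ∨f ψ) = peval v φ ∨ peval v ψ
peval v (φ ⇒ ψ)  = not (peval v φ) ∨ peval v ψ
peval v (□ φ)    = v (□ φ)
peval v (◇ φ)    = v (◇ φ)

Tautology : Formula → Set
Tautology φ = (v : Formula → Bool) → peval v φ ≡ true

-- Normal modal logics; a logic is a set (predicate) of formulas, Λ ⊢ φ is Λ φ.

record NormalLogic (Λ : Formula → Set) : Set where
  field
    taut  : ∀ φ → Tautology φ → Λ φ
    axK   : ∀ φ ψ → Λ (□ (φ ⇒ ψ) ⇒ (□ φ ⇒ □ ψ))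
    dual  : ∀ φ → Λ (◇ φ ⇔f ¬f □ ¬f φ)
    mp    : ∀ φ ψ → Λ φ → Λ (φ ⇒ ψ) → Λ ψ
    usub  : ∀ φ (σ : ℕ → Formula) → Λ φ → Λ (subst σ φ)
    nec   : ∀ φ → Λ φ → Λ (□ φ)

-- Kripke semantics on the two one-world frames.
-- oneWorld r : truth at the unique world of the one-world frame whose
-- world is reflexive (r = true, F∘) or irreflexive (r = false, F•),
-- under valuation V of the propositional variables.

oneWorld : Bool → (ℕ → Bool) → Formula → Bool
oneWorld r V (var x)  = V x
oneWorld r V ⊥f       = false
oneWorld r V (¬f φ)   = not (oneWorld r V φ)
oneWorld r V (φ ∧f ψ) = oneWorld r V φ ∧ oneWorld r V ψ
oneWorld r V (φ ∨f ψ) = oneWorld r V φ ∨ oneWorld r V ψ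
oneWorld r V (φ ⇒ ψ)  = not (oneWorld r V φ) ∨ oneWorld r V ψ
-- □φ: φ holds at all successors (the world itself if reflexive, none otherwise)
oneWorld r V (□ φ)    = if r then oneWorld r V φ else true
oneWorld r V (◇ φ)    = if r then oneWorld r V φ else false

F∘⊨_ : Formula → Set
F∘⊨ φ = (V : ℕ → Bool) → oneWorld true V φ ≡ true

F•⊨_ : Formula → Set
F•⊨ φ = (V : ℕ → Bool) → oneWorld false V φ ≡ true

TypeA : (Formula → Set) → Set
TypeA Λ = ∀ φ → Λ φ → F∘⊨ φ

TypeB : (Formula → Set) → Set
TypeB Λ = (∀ φ → Λ φ → F•⊨ φ) × Σ ℕ (λ n → Λ (□^ (suc n) ⊥f))

data ML (Φ : List Formula) : Formula → Set where
  mlvar : ∀ x → ML Φ (var x)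
  mlsub : ∀ {φ} → φ ∈ Φ → (σ : ℕ → Formula) → (∀ i → ML Φ (σ i))
        → ML Φ (subst σ φ)

_⪯[_]_ : List Formula → (Formula → Set) → List Formula → Set
Φ ⪯[ Λ ] Ψ = ∀ φ → ML Φ φ → Σ Formula (λ ψ → ML Ψ ψ × Λ (φ ⇔f ψ))

data Modality : Set where
  dia box : Modality

data Propositional : Formula → Set where
  pvar : ∀ x → Propositional (var x)
  p⊥   : Propositional ⊥f
  p¬   : ∀ {φ} → Propositional φ → Propositional (¬f φ)
  p∧   : ∀ {φ ψ} → Propositional φ → Propositional ψ → Propositional (φ ∧f ψ)
  p∨   : ∀ {φ ψ} → Propositional φ → Propositional ψ → Propositional (φ ∨f ψ)
  p⇒   : ∀ {φ ψ} → Propositional φ → Propositional ψ → Propositional (φ ⇒ ψ)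

data SimpleMember (M : Modality → Bool) : Formula → Set where
  sdia  : ∀ x → M dia ≡ true → SimpleMember M (◇ var x)
  sbox  : ∀ x → M box ≡ true → SimpleMember M (□ var x)
  sprop : ∀ {φ} → Propositional φ → SimpleMember M φ

MSimple : (Modality → Bool) → List Formula → Set
MSimple M Φ =
  All (SimpleMember M) Φ
  × (M dia ≡ true → ∃ λ x → (◇ var x) ∈ Φ)
  × (M box ≡ true → ∃ λ x → (□ var x) ∈ Φ)

-- On a one-world frame every formula denotes a Boolean function of its variables: □ and ◇
-- are the identity on F∘ and the constants ⊤ and ⊥ on F•, where for Type B they are even
-- provably so because Λ ⊢ □ⁿ⁺¹⊥. Now ML_Φ ⪯ ML_Ψ holds iff every member of Φ is Λ-equivalent
-- to a formula of ML_Ψ; for the modal members of an M-simple Φ this is automatic. For a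
-- propositional member φ it holds iff the one-world truth table of φ lies in the clone
-- generated by the meanings of the members of Ψ: necessity is soundness of Λ on the frame,
-- and conversely every element of that clone is the meaning of a propositional formula
-- which Λ proves equivalent to a formula of ML_Ψ, so Λ proves it equivalent to φ as well.
-- On the variables of φ the clone is finite, and is computed by saturating the projections
-- under composition with the members of Ψ.

module Submission where

open import Defs
open import Data.Bool using (Bool; true; false; not; _∧_; _∨_; if_then_else_; T)
open import Data.Bool.ListAction using (all)
open import Data.Bool.Properties
  using (T-≡; T-∨; ∧-conicalˡ; ∧-conicalʳ; not-involutive) renaming (_≟_ to _≟ᵇ_)
open import Data.Empty using (⊥-elim)
open import Data.Fin using (toℕ)
open import Data.List using (List; []; _∷_; length; upTo; cartesianProduct; cartesianProductWith)
open import Data.List.Membership.Propositional using (_∈_; find; lose)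
open import Data.List.Membership.Propositional.Properties
  using (∈-cartesianProduct⁺; ∈-cartesianProductWith⁺; ∈-upTo⁺; ∈-upTo⁻)
open import Data.List.Relation.Unary.All as All using (All)
open import Data.List.Relation.Unary.All.Properties using (all⁺; all⁻)
open import Data.List.Relation.Unary.Any using (Any; here; there; any?; satisfied)
open import Data.Nat using (ℕ; zero; suc; _≤_; _<_; _⊔_; _+_; z≤n; s≤s; _≤?_)
open import Data.Nat.Properties
  using ( ≤-refl; ≤-trans; ≤-reflexive; ≤-pred; ≰⇒>; <⇒≱; m≤m⊔n; m≤n⊔m; m≤n⇒m≤1+n; m≤n+m
        ; +-suc; +-monoˡ-≤; +-identityʳ)
open import Data.Product using (Σ; _×_; _,_; proj₁; proj₂)
open import Data.Product.Properties using (≡-dec)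
open import Data.Sum using (_⊎_; inj₁; inj₂)
open import Data.Unit using (⊤; tt)
open import Data.Vec using (Vec; []; _∷_; head; tabulate)
open import Data.Vec.Relation.Unary.All as VAll using ([]; _∷_) renaming (All to VAll)
open import Data.Vec.Relation.Unary.All.Properties using (tabulate⁺)
open import Function using (_∘_; _$_; flip)
open import Function.Bundles using (_⇔_; mk⇔; Equivalence)
open import Relation.Binary.Definitions using (DecidableEquality)
open import Relation.Binary.PropositionalEquality
  using (_≡_; refl; sym; trans; cong; cong₂; module ≡-Reasoning) renaming (subst to ≡-subst)
open import Relation.Nullary using (¬_; Dec; yes; no)
open import Relation.Nullary.Decidable
  using (⌊_⌋; T?; ¬?; _×-dec_; toWitness; fromWitness; decidable-stable)

_→ᵇ_ : Bool → Bool → Bool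
x →ᵇ y = not x ∨ y

_⇔ᵇ_ : Bool → Bool → Bool
x ⇔ᵇ y = (x →ᵇ y) ∧ (y →ᵇ x)

→ᵇ-intro : ∀ x y → (x ≡ true → y ≡ true) → (x →ᵇ y) ≡ true
→ᵇ-intro true  y h = h refl
→ᵇ-intro false y h = refl

→ᵇ-elim : ∀ {x y} → (x →ᵇ y) ≡ true → x ≡ true → y ≡ true
→ᵇ-elim h refl = h

⇔ᵇ-intro : ∀ x y → x ≡ y → (x ⇔ᵇ y) ≡ true
⇔ᵇ-intro true  .true  refl = refl
⇔ᵇ-intro false .false refl = refl

⇔ᵇ-elim : ∀ x y → (x ⇔ᵇ y) ≡ true → x ≡ y
⇔ᵇ-elim true  true  _ = refl
⇔ᵇ-elim false false _ = refl
⇔ᵇ-elim true  false ()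
⇔ᵇ-elim false true  ()

⇔ᵇ-sym : ∀ x y → ((x ⇔ᵇ y) →ᵇ (y ⇔ᵇ x)) ≡ true
⇔ᵇ-sym x y = →ᵇ-intro (x ⇔ᵇ y) (y ⇔ᵇ x) λ e → ⇔ᵇ-intro y x (sym (⇔ᵇ-elim x y e))

⇔ᵇ-trans : ∀ x y z → ((x ⇔ᵇ y) →ᵇ ((y ⇔ᵇ z) →ᵇ (x ⇔ᵇ z))) ≡ true
⇔ᵇ-trans x y z = →ᵇ-intro (x ⇔ᵇ y) _ λ e → →ᵇ-intro (y ⇔ᵇ z) (x ⇔ᵇ z) λ e′ →
  ⇔ᵇ-intro x z (trans (⇔ᵇ-elim x y e) (⇔ᵇ-elim y z e′))

⇔ᵇ-to : ∀ x y → ((x ⇔ᵇ y) →ᵇ (x →ᵇ y)) ≡ true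
⇔ᵇ-to x y = →ᵇ-intro (x ⇔ᵇ y) (x →ᵇ y) (∧-conicalˡ (x →ᵇ y) (y →ᵇ x))

⇔ᵇ-from : ∀ x y → ((x ⇔ᵇ y) →ᵇ (y →ᵇ x)) ≡ true
⇔ᵇ-from x y = →ᵇ-intro (x ⇔ᵇ y) (y →ᵇ x) (∧-conicalʳ (x →ᵇ y) (y →ᵇ x))

→ᵇ-antisym : ∀ x y → ((x →ᵇ y) →ᵇ ((y →ᵇ x) →ᵇ (x ⇔ᵇ y))) ≡ true
→ᵇ-antisym x y = →ᵇ-intro (x →ᵇ y) _ λ e → →ᵇ-intro (y →ᵇ x) (x ⇔ᵇ y) (cong₂ _∧_ e)

⇔ᵇ-cong : ∀ (f : Bool → Bool) x y → ((x ⇔ᵇ y) →ᵇ (f x ⇔ᵇ f y)) ≡ true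
⇔ᵇ-cong f x y = →ᵇ-intro (x ⇔ᵇ y) (f x ⇔ᵇ f y) λ e →
  ⇔ᵇ-intro (f x) (f y) (cong f (⇔ᵇ-elim x y e))

⇔ᵇ-cong₂ : ∀ (_⊙_ : Bool → Bool → Bool) x y z w
         → ((x ⇔ᵇ y) →ᵇ ((z ⇔ᵇ w) →ᵇ ((x ⊙ z) ⇔ᵇ (y ⊙ w)))) ≡ true
⇔ᵇ-cong₂ _⊙_ x y z w = →ᵇ-intro (x ⇔ᵇ y) _ λ e → →ᵇ-intro (z ⇔ᵇ w) ((x ⊙ z) ⇔ᵇ (y ⊙ w)) λ e′ →
  ⇔ᵇ-intro (x ⊙ z) (y ⊙ w) (cong₂ _⊙_ (⇔ᵇ-elim x y e) (⇔ᵇ-elim z w e′))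

⇔ᵇ-true : ∀ x → (x →ᵇ (x ⇔ᵇ true)) ≡ true
⇔ᵇ-true x = →ᵇ-intro x (x ⇔ᵇ true) (⇔ᵇ-intro x true)

⇔ᵇ-false : ∀ x → (not x →ᵇ (x ⇔ᵇ false)) ≡ true
⇔ᵇ-false x = →ᵇ-intro (not x) (x ⇔ᵇ false) λ e →
  ⇔ᵇ-intro x false (trans (sym (not-involutive x)) (cong not e))

→ᵇ-dual : ∀ x y z → ((x →ᵇ y) →ᵇ ((z ⇔ᵇ not y) →ᵇ (x →ᵇ not z))) ≡ true
→ᵇ-dual x y z = →ᵇ-intro (x →ᵇ y) _ λ e → →ᵇ-intro (z ⇔ᵇ not y) _ λ e′ → →ᵇ-intro x (not z) λ e″ →
  cong not (trans (⇔ᵇ-elim z (not y) e′) (cong not (→ᵇ-elim e e″)))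

private
  variable
    A : Set

lookupOr : ∀ {k} → A → Vec A k → ℕ → A
lookupOr d []       i       = d
lookupOr d (x ∷ xs) zero    = x
lookupOr d (x ∷ xs) (suc i) = lookupOr d xs i

lookupOr-tabulate : ∀ {k} d (f : ℕ → A) {i} → i < k → lookupOr d (tabulate {n = k} (f ∘ toℕ)) i ≡ f i
lookupOr-tabulate {k = suc k} d f {zero}  _       = refl
lookupOr-tabulate {k = suc k} d f {suc i} (s≤s p) = lookupOr-tabulate d (f ∘ suc) p

lookupOr-beyond : ∀ {k} d (xs : Vec A k) {i} → k ≤ i → lookupOr d xs i ≡ d
lookupOr-beyond d []       _       = refl
lookupOr-beyond d (x ∷ xs) (s≤s p) = lookupOr-beyond d xs p

lookupOr-All : ∀ {P : A → Set} {d k} {xs : Vec A k} → P d → VAll P xs → ∀ i → P (lookupOr d xs i)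
lookupOr-All pd []         i       = pd
lookupOr-All pd (px ∷ pxs) zero    = px
lookupOr-All pd (px ∷ pxs) (suc i) = lookupOr-All pd pxs i

allVecs : List A → ∀ k → List (Vec A k)
allVecs xs zero    = [] ∷ []
allVecs xs (suc k) = cartesianProductWith _∷_ xs (allVecs xs k)

∈-allVecs : ∀ {xs : List A} → (∀ a → a ∈ xs) → ∀ {k} (v : Vec A k) → v ∈ allVecs xs k
∈-allVecs complete []      = here refl
∈-allVecs complete (a ∷ v) = ∈-cartesianProductWith⁺ _∷_ (complete a) (∈-allVecs complete v)

TruthTable : ℕ → Set
TruthTable zero    = Bool
TruthTable (suc n) = TruthTable n × TruthTable n

fromTable : ∀ {n} → TruthTable n → Vec Bool n → Bool
fromTable b       []          = b
fromTable (f , t) (false ∷ v) = fromTable f v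
fromTable (f , t) (true  ∷ v) = fromTable t v

toTable : ∀ {n} → (Vec Bool n → Bool) → TruthTable n
toTable {zero}  f = f []
toTable {suc n} f = toTable (f ∘ (false ∷_)) , toTable (f ∘ (true ∷_))

fromTable-toTable : ∀ {n} (f : Vec Bool n → Bool) v → fromTable (toTable f) v ≡ f v
fromTable-toTable f []          = refl
fromTable-toTable f (false ∷ v) = fromTable-toTable (f ∘ (false ∷_)) v
fromTable-toTable f (true  ∷ v) = fromTable-toTable (f ∘ (true ∷_)) v

toTable-cong : ∀ {n} {f g : Vec Bool n → Bool} → (∀ v → f v ≡ g v) → toTable f ≡ toTable g
toTable-cong {zero}  h = h []
toTable-cong {suc n} h = cong₂ _,_ (toTable-cong (h ∘ (false ∷_))) (toTable-cong (h ∘ (true ∷_)))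

_≟ᵗ_ : ∀ {n} → DecidableEquality (TruthTable n)
_≟ᵗ_ {zero}  = _≟ᵇ_
_≟ᵗ_ {suc n} = ≡-dec _≟ᵗ_ _≟ᵗ_

allTables : ∀ n → List (TruthTable n)
allTables zero    = true ∷ false ∷ []
allTables (suc n) = cartesianProduct (allTables n) (allTables n)

∈-allTables : ∀ {n} (t : TruthTable n) → t ∈ allTables n
∈-allTables {zero}  true    = here refl
∈-allTables {zero}  false   = there (here refl)
∈-allTables {suc n} (f , t) = ∈-cartesianProduct⁺ (∈-allTables f) (∈-allTables t)

module Saturation {A : Set} (U : List A) (∈U : ∀ a → a ∈ U)
                  (step : (A → Bool) → A → Bool)
                  (step-extensive : ∀ S {a} → T (S a) → T (step S a)) where

  Closed : (A → Bool) → Set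
  Closed S = ∀ a → T (step S a) → T (S a)

  size : (A → Bool) → List A → ℕ
  size S []       = 0
  size S (a ∷ as) = if S a then suc (size S as) else size S as

  size≤length : ∀ S as → size S as ≤ length as
  size≤length S []       = z≤n
  size≤length S (a ∷ as) with S a
  ... | true  = s≤s (size≤length S as)
  ... | false = m≤n⇒m≤1+n (size≤length S as)

  size-step : ∀ S as → size S as ≤ size (step S) as
  size-step S []       = z≤n
  size-step S (a ∷ as) with S a | step S a | step-extensive S {a}
  ... | true  | true  | _   = s≤s (size-step S as)
  ... | true  | false | ext = ⊥-elim (ext tt)
  ... | false | true  | _   = m≤n⇒m≤1+n (size-step S as)
  ... | false | false | _   = size-step S as

  size-step-new : ∀ S {a as} → a ∈ as → T (step S a) → ¬ T (S a) → size S as < size (step S) as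
  size-step-new S {as = b ∷ as} (here refl) new old with S b | step S b
  ... | true  | _     = ⊥-elim (old tt)
  ... | false | true  = s≤s (size-step S as)
  ... | false | false = ⊥-elim new
  size-step-new S {as = b ∷ as} (there a∈as) new old with S b | step S b | step-extensive S {b}
  ... | true  | true  | _   = s≤s (size-step-new S a∈as new old)
  ... | true  | false | ext = ⊥-elim (ext tt)
  ... | false | true  | _   = m≤n⇒m≤1+n (size-step-new S a∈as new old)
  ... | false | false | _   = size-step-new S a∈as new old

  NewElement : (A → Bool) → A → Set
  NewElement S a = T (step S a) × ¬ T (S a)

  newElement? : ∀ S → Dec (Any (NewElement S) U)
  newElement? S = any? (λ a → T? (step S a) ×-dec ¬? (T? (S a))) U

  iterate : ℕ → (A → Bool) → A → Bool
  iterate zero    S = S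
  iterate (suc n) S with newElement? S
  ... | yes _ = iterate n (step S)
  ... | no  _ = S

  iterate-closed : ∀ n S → length U < size S U + n → Closed (iterate n S)
  iterate-closed zero S h =
    ⊥-elim (<⇒≱ h (≤-trans (≤-reflexive (+-identityʳ _)) (size≤length S U)))
  iterate-closed (suc n) S h with newElement? S
  ... | yes some = iterate-closed n (step S) (≤-trans h (≤-trans (≤-reflexive (+-suc _ n)) grows))
    where
    grows : suc (size S U) + n ≤ size (step S) U + n
    grows = let _ , a∈U , new , old = find some in +-monoˡ-≤ n (size-step-new S a∈U new old)
  ... | no none = λ a new → decidable-stable (T? (S a)) λ old → none (lose (∈U a) (new , old))

  iterate-⊇ : ∀ n S {a} → T (S a) → T (iterate n S a)
  iterate-⊇ zero    S s = s
  iterate-⊇ (suc n) S s with newElement? S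
  ... | yes _ = iterate-⊇ n (step S) (step-extensive S s)
  ... | no  _ = s

  iterate-ind : (P : A → Set) → (∀ S → (∀ a → T (S a) → P a) → ∀ a → T (step S a) → P a)
              → ∀ n S → (∀ a → T (S a) → P a) → ∀ a → T (iterate n S a) → P a
  iterate-ind P preserved zero    S base = base
  iterate-ind P preserved (suc n) S base with newElement? S
  ... | yes _ = iterate-ind P preserved n (step S) (preserved S base)
  ... | no  _ = base

  -- Every round but the last adds an element of U.
  saturate : (A → Bool) → A → Bool
  saturate = iterate (suc (length U))

  saturate-closed : ∀ S → Closed (saturate S)
  saturate-closed S = iterate-closed (suc (length U)) S (m≤n+m _ (size S U))

  saturate-⊇ : ∀ S {a} → T (S a) → T (saturate S a)
  saturate-⊇ = iterate-⊇ (suc (length U))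

  saturate-ind : (P : A → Set) → (∀ S → (∀ a → T (S a) → P a) → ∀ a → T (step S a) → P a)
               → ∀ S → (∀ a → T (S a) → P a) → ∀ a → T (saturate S a) → P a
  saturate-ind P preserved = iterate-ind P preserved (suc (length U))

maxVar : Formula → ℕ
maxVar (var x)  = x
maxVar ⊥f       = 0
maxVar (¬f φ)   = maxVar φ
maxVar (φ ∧f ψ) = maxVar φ ⊔ maxVar ψ
maxVar (φ ∨f ψ) = maxVar φ ⊔ maxVar ψ
maxVar (φ ⇒ ψ)  = maxVar φ ⊔ maxVar ψ
maxVar (□ φ)    = maxVar φ
maxVar (◇ φ)    = maxVar φ

module _ {P : ℕ → Set} {m n : ℕ} (h : ∀ i → i ≤ m ⊔ n → P i) where
  ⊔-boundˡ : ∀ i → i ≤ m → P i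
  ⊔-boundˡ i p = h i (≤-trans p (m≤m⊔n m n))

  ⊔-boundʳ : ∀ i → i ≤ n → P i
  ⊔-boundʳ i p = h i (≤-trans p (m≤n⊔m m n))

oneWorld-cong : ∀ r φ {V W : ℕ → Bool} → (∀ i → i ≤ maxVar φ → V i ≡ W i)
              → oneWorld r V φ ≡ oneWorld r W φ
oneWorld-cong r (var x)  h = h x ≤-refl
oneWorld-cong r ⊥f       h = refl
oneWorld-cong r (¬f φ)   h = cong not (oneWorld-cong r φ h)
oneWorld-cong r (φ ∧f ψ) h = cong₂ _∧_ (oneWorld-cong r φ (⊔-boundˡ h)) (oneWorld-cong r ψ (⊔-boundʳ h))
oneWorld-cong r (φ ∨f ψ) h = cong₂ _∨_ (oneWorld-cong r φ (⊔-boundˡ h)) (oneWorld-cong r ψ (⊔-boundʳ h))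
oneWorld-cong r (φ ⇒ ψ)  h = cong₂ _→ᵇ_ (oneWorld-cong r φ (⊔-boundˡ h)) (oneWorld-cong r ψ (⊔-boundʳ h))
oneWorld-cong r (□ φ)    h = cong (λ b → if r then b else true) (oneWorld-cong r φ h)
oneWorld-cong r (◇ φ)    h = cong (λ b → if r then b else false) (oneWorld-cong r φ h)

oneWorld-subst : ∀ r σ V φ → oneWorld r V (subst σ φ) ≡ oneWorld r (λ i → oneWorld r V (σ i)) φ
oneWorld-subst r σ V (var x)  = refl
oneWorld-subst r σ V ⊥f       = refl
oneWorld-subst r σ V (¬f φ)   = cong not (oneWorld-subst r σ V φ)
oneWorld-subst r σ V (φ ∧f ψ) = cong₂ _∧_ (oneWorld-subst r σ V φ) (oneWorld-subst r σ V ψ)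
oneWorld-subst r σ V (φ ∨f ψ) = cong₂ _∨_ (oneWorld-subst r σ V φ) (oneWorld-subst r σ V ψ)
oneWorld-subst r σ V (φ ⇒ ψ)  = cong₂ _→ᵇ_ (oneWorld-subst r σ V φ) (oneWorld-subst r σ V ψ)
oneWorld-subst r σ V (□ φ)    = cong (λ b → if r then b else true) (oneWorld-subst r σ V φ)
oneWorld-subst r σ V (◇ φ)    = cong (λ b → if r then b else false) (oneWorld-subst r σ V φ)

subst-subst : ∀ σ τ φ → subst σ (subst τ φ) ≡ subst (subst σ ∘ τ) φ
subst-subst σ τ (var x)  = refl
subst-subst σ τ ⊥f       = refl
subst-subst σ τ (¬f φ)   = cong ¬f_ (subst-subst σ τ φ)
subst-subst σ τ (φ ∧f ψ) = cong₂ _∧f_ (subst-subst σ τ φ) (subst-subst σ τ ψ)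
subst-subst σ τ (φ ∨f ψ) = cong₂ _∨f_ (subst-subst σ τ φ) (subst-subst σ τ ψ)
subst-subst σ τ (φ ⇒ ψ)  = cong₂ _⇒_ (subst-subst σ τ φ) (subst-subst σ τ ψ)
subst-subst σ τ (□ φ)    = cong □_ (subst-subst σ τ φ)
subst-subst σ τ (◇ φ)    = cong ◇_ (subst-subst σ τ φ)

subst-var : ∀ φ → subst var φ ≡ φ
subst-var (var x)  = refl
subst-var ⊥f       = refl
subst-var (¬f φ)   = cong ¬f_ (subst-var φ)
subst-var (φ ∧f ψ) = cong₂ _∧f_ (subst-var φ) (subst-var ψ)
subst-var (φ ∨f ψ) = cong₂ _∨f_ (subst-var φ) (subst-var ψ)
subst-var (φ ⇒ ψ)  = cong₂ _⇒_ (subst-var φ) (subst-var ψ)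
subst-var (□ φ)    = cong □_ (subst-var φ)
subst-var (◇ φ)    = cong ◇_ (subst-var φ)

ML-member : ∀ {Φ φ} → φ ∈ Φ → ML Φ φ
ML-member {φ = φ} φ∈Φ = ≡-subst (ML _) (subst-var φ) (mlsub φ∈Φ var mlvar)

ML-subst : ∀ {Ψ χ} {σ : ℕ → Formula} → ML Ψ χ → (∀ i → ML Ψ (σ i)) → ML Ψ (subst σ χ)
ML-subst (mlvar x) mlσ = mlσ x
ML-subst {σ = σ} (mlsub {g} g∈Ψ τ mlτ) mlσ rewrite subst-subst σ τ g =
  mlsub g∈Ψ (subst σ ∘ τ) (λ i → ML-subst (mlτ i) mlσ)

ML-□ : ∀ {Ψ χ y} → (□ var y) ∈ Ψ → ML Ψ χ → ML Ψ (□ χ)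
ML-□ □y∈Ψ ml = mlsub □y∈Ψ (λ _ → _) (λ _ → ml)

ML-◇ : ∀ {Ψ χ y} → (◇ var y) ∈ Ψ → ML Ψ χ → ML Ψ (◇ χ)
ML-◇ ◇y∈Ψ ml = mlsub ◇y∈Ψ (λ _ → _) (λ _ → ml)

◇^ : ℕ → Formula → Formula
◇^ zero    φ = φ
◇^ (suc n) φ = ◇ (◇^ n φ)

ML-□^ : ∀ {Ψ χ y} → (□ var y) ∈ Ψ → ML Ψ χ → ∀ n → ML Ψ (□^ n χ)
ML-□^ □y∈Ψ ml zero    = ml
ML-□^ □y∈Ψ ml (suc n) = ML-□ □y∈Ψ (ML-□^ □y∈Ψ ml n)

ML-◇^ : ∀ {Ψ χ y} → (◇ var y) ∈ Ψ → ML Ψ χ → ∀ n → ML Ψ (◇^ n χ)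
ML-◇^ ◇y∈Ψ ml zero    = ml
ML-◇^ ◇y∈Ψ ml (suc n) = ML-◇ ◇y∈Ψ (ML-◇^ ◇y∈Ψ ml n)

Propositional-subst : ∀ {g} {σ : ℕ → Formula} → Propositional g → (∀ i → Propositional (σ i))
                    → Propositional (subst σ g)
Propositional-subst (pvar x)  pσ = pσ x
Propositional-subst p⊥        pσ = p⊥
Propositional-subst (p¬ p)    pσ = p¬ (Propositional-subst p pσ)
Propositional-subst (p∧ p q)  pσ = p∧ (Propositional-subst p pσ) (Propositional-subst q pσ)
Propositional-subst (p∨ p q)  pσ = p∨ (Propositional-subst p pσ) (Propositional-subst q pσ)
Propositional-subst (p⇒ p q)  pσ = p⇒ (Propositional-subst p pσ) (Propositional-subst q pσ)

peval-propositional : ∀ r {φ} → Propositional φ → ∀ v → peval v φ ≡ oneWorld r (v ∘ var) φ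
peval-propositional r (pvar x)  v = refl
peval-propositional r p⊥        v = refl
peval-propositional r (p¬ p)    v = cong not (peval-propositional r p v)
peval-propositional r (p∧ p q)  v = cong₂ _∧_ (peval-propositional r p v) (peval-propositional r q v)
peval-propositional r (p∨ p q)  v = cong₂ _∨_ (peval-propositional r p v) (peval-propositional r q v)
peval-propositional r (p⇒ p q)  v = cong₂ _→ᵇ_ (peval-propositional r p v) (peval-propositional r q v)

tautology : ∀ r {φ} → Propositional φ → (∀ V → oneWorld r V φ ≡ true) → Tautology φ
tautology r p valid v = trans (peval-propositional r p v) (valid (v ∘ var))

module NormalLogicReasoning {Λ : Formula → Set} (NL : NormalLogic Λ) where
  open NormalLogic NL

  ⊢-taut₁ : ∀ {a b} → Λ a → Tautology (a ⇒ b) → Λ b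
  ⊢-taut₁ ⊢a taut-a⇒b = mp _ _ ⊢a (taut _ taut-a⇒b)

  ⊢-taut₂ : ∀ {a b c} → Λ a → Λ b → Tautology (a ⇒ b ⇒ c) → Λ c
  ⊢-taut₂ ⊢a ⊢b taut-a⇒b⇒c = mp _ _ ⊢b (mp _ _ ⊢a (taut _ taut-a⇒b⇒c))

  ⇔-refl : ∀ {a} → Λ (a ⇔f a)
  ⇔-refl {a} = taut _ λ v → ⇔ᵇ-intro (peval v a) _ refl

  ⇔-sym : ∀ {a b} → Λ (a ⇔f b) → Λ (b ⇔f a)
  ⇔-sym {a} {b} ⊢a⇔b = ⊢-taut₁ ⊢a⇔b λ v → ⇔ᵇ-sym (peval v a) (peval v b)

  ⇔-trans : ∀ {a b c} → Λ (a ⇔f b) → Λ (b ⇔f c) → Λ (a ⇔f c)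
  ⇔-trans {a} {b} {c} ⊢a⇔b ⊢b⇔c =
    ⊢-taut₂ ⊢a⇔b ⊢b⇔c λ v → ⇔ᵇ-trans (peval v a) (peval v b) (peval v c)

  ⇔-to : ∀ {a b} → Λ (a ⇔f b) → Λ (a ⇒ b)
  ⇔-to {a} {b} ⊢a⇔b = ⊢-taut₁ ⊢a⇔b λ v → ⇔ᵇ-to (peval v a) (peval v b)

  ⇔-from : ∀ {a b} → Λ (a ⇔f b) → Λ (b ⇒ a)
  ⇔-from {a} {b} ⊢a⇔b = ⊢-taut₁ ⊢a⇔b λ v → ⇔ᵇ-from (peval v a) (peval v b)

  ⇔-intro : ∀ {a b} → Λ (a ⇒ b) → Λ (b ⇒ a) → Λ (a ⇔f b)
  ⇔-intro {a} {b} ⊢a⇒b ⊢b⇒a = ⊢-taut₂ ⊢a⇒b ⊢b⇒a λ v → →ᵇ-antisym (peval v a) (peval v b)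

  ¬-cong : ∀ {a b} → Λ (a ⇔f b) → Λ (¬f a ⇔f ¬f b)
  ¬-cong {a} {b} ⊢a⇔b = ⊢-taut₁ ⊢a⇔b λ v → ⇔ᵇ-cong not (peval v a) (peval v b)

  ∧-cong : ∀ {a b c d} → Λ (a ⇔f b) → Λ (c ⇔f d) → Λ ((a ∧f c) ⇔f (b ∧f d))
  ∧-cong {a} {b} {c} {d} ⊢a⇔b ⊢c⇔d = ⊢-taut₂ ⊢a⇔b ⊢c⇔d λ v →
    ⇔ᵇ-cong₂ _∧_ (peval v a) (peval v b) (peval v c) (peval v d)

  ∨-cong : ∀ {a b c d} → Λ (a ⇔f b) → Λ (c ⇔f d) → Λ ((a ∨f c) ⇔f (b ∨f d))
  ∨-cong {a} {b} {c} {d} ⊢a⇔b ⊢c⇔d = ⊢-taut₂ ⊢a⇔b ⊢c⇔d λ v →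
    ⇔ᵇ-cong₂ _∨_ (peval v a) (peval v b) (peval v c) (peval v d)

  ⇒-cong : ∀ {a b c d} → Λ (a ⇔f b) → Λ (c ⇔f d) → Λ ((a ⇒ c) ⇔f (b ⇒ d))
  ⇒-cong {a} {b} {c} {d} ⊢a⇔b ⊢c⇔d = ⊢-taut₂ ⊢a⇔b ⊢c⇔d λ v →
    ⇔ᵇ-cong₂ _→ᵇ_ (peval v a) (peval v b) (peval v c) (peval v d)

  □-mono : ∀ {a b} → Λ (a ⇒ b) → Λ (□ a ⇒ □ b)
  □-mono ⊢a⇒b = mp _ _ (nec _ ⊢a⇒b) (axK _ _)

  □-cong : ∀ {a b} → Λ (a ⇔f b) → Λ (□ a ⇔f □ b)
  □-cong ⊢a⇔b = ⇔-intro (□-mono (⇔-to ⊢a⇔b)) (□-mono (⇔-from ⊢a⇔b))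

  ◇-cong : ∀ {a b} → Λ (a ⇔f b) → Λ (◇ a ⇔f ◇ b)
  ◇-cong ⊢a⇔b = ⇔-trans (dual _) (⇔-trans (¬-cong (□-cong (¬-cong ⊢a⇔b))) (⇔-sym (dual _)))

  subst-cong : ∀ χ {σ τ : ℕ → Formula} → (∀ i → Λ (σ i ⇔f τ i))
             → Λ (subst σ χ ⇔f subst τ χ)
  subst-cong (var x)  h = h x
  subst-cong ⊥f       h = ⇔-refl
  subst-cong (¬f χ)   h = ¬-cong (subst-cong χ h)
  subst-cong (χ ∧f ψ) h = ∧-cong (subst-cong χ h) (subst-cong ψ h)
  subst-cong (χ ∨f ψ) h = ∨-cong (subst-cong χ h) (subst-cong ψ h)
  subst-cong (χ ⇒ ψ)  h = ⇒-cong (subst-cong χ h) (subst-cong ψ h)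
  subst-cong (□ χ)    h = □-cong (subst-cong χ h)
  subst-cong (◇ χ)    h = ◇-cong (subst-cong χ h)

  □ⁿ⊥⇒□ⁿ : ∀ n χ → Λ (□^ n ⊥f ⇒ □^ n χ)
  □ⁿ⊥⇒□ⁿ zero    χ = taut _ λ v → refl
  □ⁿ⊥⇒□ⁿ (suc n) χ = □-mono (□ⁿ⊥⇒□ⁿ n χ)

  □ⁿ⊥⇒¬◇ⁿ : ∀ n χ → Λ (□^ n ⊥f ⇒ ¬f ◇^ n χ)
  □ⁿ⊥⇒¬◇ⁿ zero    χ = taut _ λ v → refl
  □ⁿ⊥⇒¬◇ⁿ (suc n) χ = ⊢-taut₂ (□-mono (□ⁿ⊥⇒¬◇ⁿ n χ)) (dual (◇^ n χ)) λ v →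
    →ᵇ-dual (peval v (□^ (suc n) ⊥f)) (peval v (□ ¬f ◇^ n χ)) (peval v (◇^ (suc n) χ))

  □ⁿ⁺¹-⊤ : ∀ {n} → Λ (□^ (suc n) ⊥f) → ∀ χ → Λ (□^ (suc n) χ ⇔f ¬f ⊥f)
  □ⁿ⁺¹-⊤ {n} ⊢□ⁿ⁺¹⊥ χ = ⊢-taut₁ (mp _ _ ⊢□ⁿ⁺¹⊥ (□ⁿ⊥⇒□ⁿ (suc n) χ)) λ v →
    ⇔ᵇ-true (peval v (□^ (suc n) χ))

  ◇ⁿ⁺¹-⊥ : ∀ {n} → Λ (□^ (suc n) ⊥f) → ∀ χ → Λ (◇^ (suc n) χ ⇔f ⊥f)
  ◇ⁿ⁺¹-⊥ {n} ⊢□ⁿ⁺¹⊥ χ = ⊢-taut₁ (mp _ _ ⊢□ⁿ⁺¹⊥ (□ⁿ⊥⇒¬◇ⁿ (suc n) χ)) λ v →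
    ⇔ᵇ-false (peval v (◇^ (suc n) χ))

-- Definability and realisers

Definable : (Formula → Set) → List Formula → Formula → Set
Definable Λ Ψ φ = Σ Formula λ ψ → ML Ψ ψ × Λ (φ ⇔f ψ)

module _ {Λ : Formula → Set} (NL : NormalLogic Λ) {Φ Ψ : List Formula} where
  open NormalLogic NL using (usub)
  open NormalLogicReasoning NL

  ML-definable : All (Definable Λ Ψ) Φ → ∀ {φ} → ML Φ φ → Definable Λ Ψ φ
  ML-definable defΦ (mlvar x) = var x , mlvar x , ⇔-refl
  ML-definable defΦ (mlsub {g} g∈Φ σ mlσ) =
    subst (proj₁ ∘ IH) ψ , ML-subst mlψ (proj₁ ∘ proj₂ ∘ IH) ,
    ⇔-trans (usub _ σ ⊢g⇔ψ) (subst-cong ψ (proj₂ ∘ proj₂ ∘ IH))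
    where
    IH : ∀ i → Definable Λ Ψ (σ i)
    IH i = ML-definable defΦ (mlσ i)
    ψ = proj₁ (All.lookup defΦ g∈Φ)
    mlψ = proj₁ (proj₂ (All.lookup defΦ g∈Φ))
    ⊢g⇔ψ = proj₂ (proj₂ (All.lookup defΦ g∈Φ))

  ⪯⇔All-definable : (Φ ⪯[ Λ ] Ψ) ⇔ All (Definable Λ Ψ) Φ
  ⪯⇔All-definable = mk⇔ (λ Φ⪯Ψ → All.tabulate λ g∈Φ → Φ⪯Ψ _ (ML-member g∈Φ))
                         (λ defΦ _ → ML-definable defΦ)

Sound : (Formula → Set) → Bool → Set
Sound Λ r = ∀ φ → Λ φ → ∀ V → oneWorld r V φ ≡ true

-- On F•, Λ ⊢ □ⁿ⁺¹⊥ is what makes □ⁿ⁺¹φ and ◇ⁿ⁺¹φ provably the constants they denote.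
ModalCollapse : (Formula → Set) → Bool → Set
ModalCollapse Λ true  = ⊤
ModalCollapse Λ false = Σ ℕ λ n → Λ (□^ (suc n) ⊥f)

record Realiser (Λ : Formula → Set) (Ψ : List Formula) (r : Bool) (f : (ℕ → Bool) → Bool) : Set where
  constructor realiser
  field
    formula               : Formula
    formula∈ML            : ML Ψ formula
    normal                : Formula
    normal-propositional  : Propositional normal
    formula⇔normal        : Λ (formula ⇔f normal)
    normal-meaning        : ∀ V → oneWorld r V normal ≡ f V

module _ {Λ : Formula → Set} (NL : NormalLogic Λ) {Ψ : List Formula} where
  open NormalLogicReasoning NL
  open Realiser

  realise-var : ∀ {r} x → Realiser Λ Ψ r (λ V → V x)
  realise-var x = realiser (var x) (mlvar x) (var x) (pvar x) ⇔-refl (λ _ → refl)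

  realise-ext : ∀ {r f g} → (∀ V → f V ≡ g V) → Realiser Λ Ψ r f → Realiser Λ Ψ r g
  realise-ext f≗g (realiser ψ mlψ n pn ⊢ψ⇔n meaning) =
    realiser ψ mlψ n pn ⊢ψ⇔n (λ V → trans (meaning V) (f≗g V))

  realise-subst : ∀ {r g} {fs : ℕ → (ℕ → Bool) → Bool} → Propositional g → g ∈ Ψ
                → (∀ i → Realiser Λ Ψ r (fs i)) → Realiser Λ Ψ r (λ V → oneWorld r (λ i → fs i V) g)
  realise-subst {r} {g} pg g∈Ψ R = realiser
    (subst (formula ∘ R) g) (mlsub g∈Ψ _ (formula∈ML ∘ R))
    (subst (normal ∘ R) g) (Propositional-subst pg (normal-propositional ∘ R))
    (subst-cong g (formula⇔normal ∘ R))
    (λ V → trans (oneWorld-subst r (normal ∘ R) V g) (oneWorld-cong r g λ i _ → normal-meaning (R i) V))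

  realise-□ : ∀ {r f y} → ModalCollapse Λ r → (□ var y) ∈ Ψ
            → Realiser Λ Ψ r f → Realiser Λ Ψ r (λ V → if r then f V else true)
  realise-□ {true}  _           □y∈Ψ R = R
  realise-□ {false} (n , ⊢□ⁿ⁺¹⊥) □y∈Ψ R =
    realiser (□^ (suc n) (var 0)) (ML-□^ □y∈Ψ (mlvar 0) (suc n))
             (¬f ⊥f) (p¬ p⊥) (□ⁿ⁺¹-⊤ ⊢□ⁿ⁺¹⊥ (var 0)) (λ _ → refl)

  realise-◇ : ∀ {r f y} → ModalCollapse Λ r → (◇ var y) ∈ Ψ
            → Realiser Λ Ψ r f → Realiser Λ Ψ r (λ V → if r then f V else false)
  realise-◇ {true}  _           ◇y∈Ψ R = R
  realise-◇ {false} (n , ⊢□ⁿ⁺¹⊥) ◇y∈Ψ R =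
    realiser (◇^ (suc n) (var 0)) (ML-◇^ ◇y∈Ψ (mlvar 0) (suc n))
             ⊥f p⊥ (◇ⁿ⁺¹-⊥ ⊢□ⁿ⁺¹⊥ (var 0)) (λ _ → refl)

  realise-member : ∀ {r M g} {fs : ℕ → (ℕ → Bool) → Bool}
                 → ModalCollapse Λ r → SimpleMember M g → g ∈ Ψ
                 → (∀ i → Realiser Λ Ψ r (fs i)) → Realiser Λ Ψ r (λ V → oneWorld r (λ i → fs i V) g)
  realise-member collapse (sprop pg)  g∈Ψ R = realise-subst pg g∈Ψ R
  realise-member collapse (sbox y _) g∈Ψ R = realise-□ collapse g∈Ψ (R y)
  realise-member collapse (sdia y _) g∈Ψ R = realise-◇ collapse g∈Ψ (R y)

  realiser⇒definable : ∀ {r φ} → Propositional φ → Realiser Λ Ψ r (λ V → oneWorld r V φ)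
                     → Definable Λ Ψ φ
  realiser⇒definable {r} {φ} pφ (realiser ψ mlψ n pn ⊢ψ⇔n meaning) =
    ψ , mlψ , ⇔-trans (NormalLogic.taut NL _ φ⇔n) (⇔-sym ⊢ψ⇔n)
    where
    φ⇔n : Tautology (φ ⇔f n)
    φ⇔n = tautology r (p∧ (p⇒ pφ pn) (p⇒ pn pφ)) λ V → ⇔ᵇ-intro _ _ (sym (meaning V))

-- The clone of one-world meanings of a fragment, on m + 1 variables

module Clone (r : Bool) (Ψ : List Formula) (m : ℕ) where

  Table : Set
  Table = TruthTable (suc m)

  -- Variables beyond m are read as variable 0, so that the table of every variable is a projection.
  extend : Vec Bool (suc m) → ℕ → Bool
  extend v = lookupOr (head v) v

  restrict : (ℕ → Bool) → Vec Bool (suc m)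
  restrict V = tabulate (V ∘ toℕ)

  truthTable : Formula → Table
  truthTable φ = toTable (λ v → oneWorld r (extend v) φ)

  meaning : Table → (ℕ → Bool) → Bool
  meaning t V = fromTable t (restrict V)

  meaning-truthTable : ∀ {φ} → maxVar φ ≤ m → ∀ V → meaning (truthTable φ) V ≡ oneWorld r V φ
  meaning-truthTable {φ} bound V =
    trans (fromTable-toTable (λ v → oneWorld r (extend v) φ) (restrict V))
    (oneWorld-cong r φ λ i i≤ → lookupOr-tabulate (V 0) V (s≤s (≤-trans i≤ bound)))

  truthTable-var-beyond : ∀ {x} → m < x → truthTable (var x) ≡ truthTable (var 0)
  truthTable-var-beyond {x} m<x =
    toTable-cong {f = λ v → extend v x} {g = head} λ { (b ∷ v) → lookupOr-beyond b (b ∷ v) m<x }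

  arity : Formula → ℕ
  arity g = suc (maxVar g)

  -- Columns beyond the arity are never read, but realisers are needed at every index.
  column : ∀ {k} → Vec Table k → ℕ → Table
  column = lookupOr (truthTable (var 0))

  compose : ∀ g → Vec Table (arity g) → Table
  compose g ts = toTable (λ v → oneWorld r (λ i → fromTable (column ts i) v) g)

  Generated : (Table → Bool) → Table → Set
  Generated S t =
    Any (λ g → Any (λ ts → VAll (T ∘ S) ts × compose g ts ≡ t) (allVecs (allTables (suc m)) (arity g))) Ψ

  generated? : ∀ S t → Dec (Generated S t)
  generated? S t = any? (λ g → any? (λ ts → VAll.all? (T? ∘ S) ts ×-dec (compose g ts ≟ᵗ t)) _) Ψ

  step : (Table → Bool) → Table → Bool
  step S t = S t ∨ ⌊ generated? S t ⌋

  open Saturation (allTables (suc m)) ∈-allTables step (λ S s → Equivalence.from T-∨ (inj₁ s))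

  IsVariable : Table → Set
  IsVariable t = Any (λ x → truthTable (var x) ≡ t) (upTo (suc m))

  isVariable? : ∀ t → Dec (IsVariable t)
  isVariable? t = any? (λ x → truthTable (var x) ≟ᵗ t) (upTo (suc m))

  closure : Table → Bool
  closure = saturate (⌊_⌋ ∘ isVariable?)

  small-variable∈closure : ∀ {x} → x ≤ m → T (closure (truthTable (var x)))
  small-variable∈closure x≤m = saturate-⊇ _ (fromWitness (lose (∈-upTo⁺ (s≤s x≤m)) refl))

  variable∈closure : ∀ x → T (closure (truthTable (var x)))
  variable∈closure x with x ≤? m
  ... | yes x≤m = small-variable∈closure x≤m
  ... | no  x≰m =
    ≡-subst (T ∘ closure) (sym (truthTable-var-beyond (≰⇒> x≰m))) (small-variable∈closure z≤n)

  generated⇒closure : ∀ {t} → Generated closure t → T (closure t)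
  generated⇒closure {t} gen =
    saturate-closed _ t (Equivalence.from (T-∨ {closure t}) (inj₂ (fromWitness gen)))

  compose-truthTables : ∀ g σ → compose g (tabulate (truthTable ∘ σ ∘ toℕ)) ≡ truthTable (subst σ g)
  compose-truthTables g σ = toTable-cong λ v → begin
    oneWorld r (λ i → fromTable (column ts i) v) g
      ≡⟨ oneWorld-cong r g (λ i i≤ →
           cong (flip fromTable v) (lookupOr-tabulate _ (truthTable ∘ σ) (s≤s i≤))) ⟩
    oneWorld r (λ i → fromTable (truthTable (σ i)) v) g
      ≡⟨ oneWorld-cong r g (λ i _ → fromTable-toTable (λ w → oneWorld r (extend w) (σ i)) v) ⟩
    oneWorld r (λ i → oneWorld r (extend v) (σ i)) g
      ≡⟨ oneWorld-subst r σ (extend v) g ⟨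
    oneWorld r (extend v) (subst σ g) ∎
    where
    open ≡-Reasoning
    ts : Vec Table (arity g)
    ts = tabulate (truthTable ∘ σ ∘ toℕ)

  truthTable∈closure : ∀ {ψ} → ML Ψ ψ → T (closure (truthTable ψ))
  truthTable∈closure (mlvar x) = variable∈closure x
  truthTable∈closure (mlsub {g} g∈Ψ σ mlσ) = generated⇒closure $
    lose g∈Ψ (lose (∈-allVecs ∈-allTables _) (tabulate⁺ args∈closure , compose-truthTables g σ))
    where
    args∈closure : ∀ i → T (closure (truthTable (σ (toℕ i))))
    args∈closure i = truthTable∈closure (mlσ (toℕ i))

  meaning-compose : ∀ g ts V → meaning (compose g ts) V ≡ oneWorld r (λ i → meaning (column ts i) V) g
  meaning-compose g ts V =
    fromTable-toTable (λ v → oneWorld r (λ i → fromTable (column ts i) v) g) (restrict V)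

  module _ {Λ : Formula → Set} (NL : NormalLogic Λ) (collapse : ModalCollapse Λ r)
           {M : Modality → Bool} (simpleΨ : All (SimpleMember M) Ψ) where

    Realised : Table → Set
    Realised t = Realiser Λ Ψ r (meaning t)

    variable-realised : ∀ {x} → x ≤ m → Realised (truthTable (var x))
    variable-realised {x} x≤m =
      realise-ext NL (λ V → sym (meaning-truthTable {var x} x≤m V)) (realise-var NL x)

    compose-realised : ∀ {g} → SimpleMember M g → g ∈ Ψ
                     → ∀ {ts} → VAll Realised ts → Realised (compose g ts)
    compose-realised {g} member g∈Ψ {ts} args = realise-ext NL (sym ∘ meaning-compose g ts)
      (realise-member NL collapse member g∈Ψ (lookupOr-All (variable-realised z≤n) args))

    step-realised : ∀ S → (∀ t → T (S t) → Realised t) → ∀ t → T (step S t) → Realised t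
    step-realised S realisedS t st with Equivalence.to T-∨ st
    ... | inj₁ s   = realisedS t s
    ... | inj₂ gen with find (toWitness gen)
    ... | g , g∈Ψ , some with satisfied some
    ... | ts , args , refl =
      compose-realised (All.lookup simpleΨ g∈Ψ) g∈Ψ (VAll.map (λ {t} → realisedS t) args)

    closure-realised : ∀ t → T (closure t) → Realised t
    closure-realised = saturate-ind Realised step-realised _ λ t isVar →
      let x , x∈ , x↦t = find (toWitness isVar)
      in ≡-subst Realised x↦t (variable-realised (≤-pred (∈-upTo⁻ x∈)))

-- The decision procedure

inClosure : Bool → List Formula → Formula → Bool
inClosure r Ψ φ = closure (truthTable φ)
  where open Clone r Ψ (maxVar φ)

decide : Bool → List Formula → List Formula → Bool
decide r Φ Ψ = all (inClosure r Ψ) Φ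

definable⇒inClosure : ∀ {Λ r Ψ φ} → Sound Λ r → Definable Λ Ψ φ → T (inClosure r Ψ φ)
definable⇒inClosure {r = r} {Ψ} {φ} sound (ψ , mlψ , ⊢φ⇔ψ) =
  ≡-subst (T ∘ closure) (sym (toTable-cong same-meaning)) (truthTable∈closure mlψ)
  where
  open Clone r Ψ (maxVar φ)
  same-meaning : ∀ v → oneWorld r (extend v) φ ≡ oneWorld r (extend v) ψ
  same-meaning v = ⇔ᵇ-elim _ _ (sound _ ⊢φ⇔ψ (extend v))

inClosure⇒definable : ∀ {Λ r M Ψ φ} → NormalLogic Λ → ModalCollapse Λ r
                    → MSimple M Ψ → SimpleMember M φ
                    → T (inClosure r Ψ φ) → Definable Λ Ψ φ
inClosure⇒definable {r = r} {Ψ = Ψ} {φ} NL collapse (simpleΨ , _) (sprop pφ) φ∈closure =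
  realiser⇒definable NL pφ $
    realise-ext NL (meaning-truthTable {φ} ≤-refl) (closure-realised NL collapse simpleΨ _ φ∈closure)
  where open Clone r Ψ (maxVar φ)
inClosure⇒definable NL _ (_ , hasDia , _) (sdia x M◇) _ =
  let _ , ◇y∈Ψ = hasDia M◇ in ◇ var x , ML-◇ ◇y∈Ψ (mlvar x) , NormalLogicReasoning.⇔-refl NL
inClosure⇒definable NL _ (_ , _ , hasBox) (sbox x M□) _ =
  let _ , □y∈Ψ = hasBox M□ in □ var x , ML-□ □y∈Ψ (mlvar x) , NormalLogicReasoning.⇔-refl NL

decide-correct : ∀ {Λ r M Φ Ψ} → NormalLogic Λ → Sound Λ r → ModalCollapse Λ r
               → MSimple M Φ → MSimple M Ψ
               → (decide r Φ Ψ ≡ true) ⇔ (Φ ⪯[ Λ ] Ψ)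
decide-correct {Φ = Φ} NL sound collapse (simpleΦ , _) simpleΨ = mk⇔
  (λ decided → Equivalence.from (⪯⇔All-definable NL) $
    All.zipWith (λ (member , φ∈closure) → inClosure⇒definable NL collapse simpleΨ member φ∈closure)
                (simpleΦ , all⁺ _ Φ (Equivalence.from T-≡ decided)))
  (λ Φ⪯Ψ → Equivalence.to T-≡ $ all⁻ _ $
    All.map (definable⇒inClosure sound) (Equivalence.to (⪯⇔All-definable NL) Φ⪯Ψ))

corollary4p17 : (Λ : Formula → Set) → NormalLogic Λ → TypeA Λ ⊎ TypeB Λ
    → (M : Modality → Bool)
    → Σ (List Formula → List Formula → Bool) λ decide
    → (Φ Ψ : List Formula) → MSimple M Φ → MSimple M Ψ
    → (decide Φ Ψ ≡ true) ⇔ (Φ ⪯[ Λ ] Ψ)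
corollary4p17 Λ NL (inj₁ typeA) M =
  decide true , λ Φ Ψ → decide-correct NL typeA tt
corollary4p17 Λ NL (inj₂ (typeB , ⊢□ⁿ⁺¹⊥)) M =
  decide false , λ Φ Ψ → decide-correct NL typeB ⊢□ⁿ⁺¹⊥
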